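{- Let $q$ be a prime power, and let $m, t \geq 1$ and $d \geq 0$ be integers with $q > \binom{m}{2}$ and $d \geq m - 1$. Let $f$ be a polynomial chosen uniformly at random from $\mathcal{P}_d$, the set of polynomials in $t$ variables $X = (X_1, \dots, X_t)$ of degree at most $d$ with coefficients in $\mathbb{F}_q$. Let $x_1, \dots, x_m$ be $m$ distinct points in $\overline{\mathbb{F}}_q^{\,t}$, where $\overline{\mathbb{F}}_q$ is the algebraic closure of $\mathbb{F}_q$. Then \[ \mathbb{P}[f(x_i) = 0 \text{ for all } i = 1, \dots, m] \leq q^{ -m}. \]
   Context: $\mathcal{P}_d$ denotes the set of all $\mathbb{F}_q$-linear combinations of monomials $X_1^{a_1}\cdots X_t^{a_t}$ with $\sum_i a_i \leq d$; a uniformly random element is obtained by choosing the coefficients of these monomials independently and uniformly from $\mathbb{F}_q$. -}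

module Defs where

open import Level using (Level; 0ℓ)
open import Data.Nat using (ℕ; zero; suc; _∸_)
open import Data.Fin using (Fin; zero; suc)
open import Data.List using (List; []; _∷_; [_]; _++_; map; concatMap; upTo; length)
open import Data.Vec using (Vec; []; _∷_; toList)
open import Data.Product using (Σ; ∃; _×_; _,_)
open import Relation.Nullary using (¬_)
open import Relation.Binary.PropositionalEquality using (_≡_)
open import Algebra.Core using (Op₁; Op₂)
open import Algebra.Structures using (IsCommutativeRing)
open import Algebra.Bundles using (CommutativeRing)
open import Algebra.Morphism.Structures using (IsRingHomomorphism)
import Data.Vec
open import Function using (_∘_)

IsField : ∀ {c ℓ} → CommutativeRing c ℓ → Set (c Level.⊔ ℓ)
IsField R = ¬ (1# ≈ 0#) × (∀ x → ¬ (x ≈ 0#) → ∃ λ y → x * y ≈ 1#)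
  where open CommutativeRing R using (_≈_; _*_; 0#; 1#)

-- A finite field with exactly q elements, realised on the carrier Fin q
-- (every field of order q is isomorphic to one of these).
record FiniteField (q : ℕ) : Set where
  field
    _+_ _*_   : Op₂ (Fin q)
    -_        : Op₁ (Fin q)
    0# 1#     : Fin q
    isCommutativeRing : IsCommutativeRing _≡_ _+_ _*_ -_ 0# 1#

  ring : CommutativeRing 0ℓ 0ℓ
  ring = record { isCommutativeRing = isCommutativeRing }

  field
    isField : IsField ring

-- Univariate polynomial evaluation (Horner), coefficients listed from the constant term up.
module _ {c ℓ} (K : CommutativeRing c ℓ) where
  open CommutativeRing K using (Carrier; _≈_; _+_; _*_; 0#; 1#; rawRing)

  hornerEval : List Carrier → Carrier → Carrier
  hornerEval []       y = 0#
  hornerEval (a ∷ as) y = a + y * hornerEval as y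

  monicEval : ∀ {n} → Vec Carrier n → Carrier → Carrier
  monicEval as y = hornerEval (toList as ++ [ 1# ]) y

  IsAlgebraicallyClosed : Set (c Level.⊔ ℓ)
  IsAlgebraicallyClosed = ∀ n (as : Vec Carrier (suc n)) → ∃ λ y → monicEval as y ≈ 0#

  _^ᴷ_ : Carrier → ℕ → Carrier
  y ^ᴷ zero  = 1#
  y ^ᴷ suc n = y * (y ^ᴷ n)

  monomialEval : ∀ {t} → Vec ℕ t → (Fin t → Carrier) → Carrier
  monomialEval []       x = 1#
  monomialEval (a ∷ as) x = (x zero ^ᴷ a) * monomialEval as (x ∘ suc)

record IsAlgebraicClosure {q c ℓ} (F : FiniteField q) (K : CommutativeRing c ℓ)
                          (ι : Fin q → CommutativeRing.Carrier K) : Set (c Level.⊔ ℓ) where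
  open CommutativeRing K using (Carrier; _≈_; _+_; _*_; 0#; 1#; rawRing)
  field
    isField     : IsField K
    isHom       : IsRingHomomorphism (CommutativeRing.rawRing (FiniteField.ring F)) rawRing ι
    algClosed   : IsAlgebraicallyClosed K
    algebraic   : ∀ y → ∃ λ n → Σ (Vec (Fin q) n) λ as → monicEval K (Data.Vec.map ι as) y ≈ 0#

-- All exponent vectors (a_1, ..., a_t) ∈ ℕ^t with a_1 + ... + a_t ≤ d, each listed once;
-- these index the monomials spanning 𝒫_d.
monomials : (t d : ℕ) → List (Vec ℕ t)
monomials zero    d = [ [] ]
monomials (suc t) d = concatMap (λ a → map (a ∷_) (monomials t (d ∸ a))) (upTo (suc d))

-- An element of 𝒫_d is its coefficient vector, indexed by `monomials t d`.
Poly : (q t d : ℕ) → Set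
Poly q t d = Vec (Fin q) (length (monomials t d))

module _ {q c ℓ} (K : CommutativeRing c ℓ) (ι : Fin q → CommutativeRing.Carrier K) where
  open CommutativeRing K using (Carrier; _≈_; _+_; _*_; 0#; 1#; rawRing)

  evalList : ∀ {t} (ms : List (Vec ℕ t)) → Vec (Fin q) (length ms) → (Fin t → Carrier) → Carrier
  evalList []       []       x = 0#
  evalList (a ∷ ms) (c ∷ cs) x = ι c * monomialEval K a x + evalList ms cs x

  evalPoly : ∀ {t d} → Poly q t d → (Fin t → Carrier) → Carrier
  evalPoly {t} {d} f x = evalList (monomials t d) f x

-- Counting shows that some linear form L over 𝔽_q takes distinct values at the points x_i:
-- a form with L(x_i) = L(x_j) is determined by (i, j) and its coefficients off a coordinate
-- where x_i and x_j differ, so there are at most C(m,2) q^(t-1) < q^t such forms. For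
-- c ∈ 𝔽_q^m the polynomial c(L(X)) = Σ c_k L(X)^k lies in 𝒫_d since m - 1 ≤ d, and c is
-- recovered from its values at the x_i, because a univariate polynomial of degree < m is
-- determined by its values at the m distinct points L(x_i). Hence (f, c) ↦ f + c(L(X))
-- embeds S × 𝔽_q^m into 𝒫_d. The form L is only obtained under a double negation, which
-- suffices because the conclusion is a decidable inequality.

module Submission where

open import Defs
open import Level using (_⊔_)
open import Function using (_∘_; Injective)
open import Data.Empty using (⊥-elim)
open import Data.Nat as ℕ using (ℕ; zero; suc; _≤_; _^_; _∸_; s≤s; z≤n; >-nonZero)
open import Data.Nat.Properties
  using (+-suc; m≤m+n; ≤-trans; ≤-pred; ∸-monoˡ-≤; m+n∸m≡n; <⇒≱; *-monoˡ-<; m^n≢0; ≤-<-trans; _≤?_; m≤n+m∸n)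
open import Data.Nat.Combinatorics using (_C_; nC1≡n; nCk+nC[k+1]≡[n+1]C[k+1])
open import Data.Fin as Fin
  using (Fin; zero; suc; _↑ˡ_; _↑ʳ_; splitAt; combine; remQuot; funToFin; finToFun; punchIn; punchOut)
open import Data.Fin.Properties
  using ( suc-injective; ↑ˡ-injective; ↑ʳ-injective; splitAt-↑ˡ; splitAt-↑ʳ; combine-remQuot; combine-injective
        ; funToFin-finToFin; finToFun-funToFin; injective⇒≤; punchIn-punchOut; <-cmp; <-irrelevant; <⇒≢; ¬∀⟶∃¬)
open import Data.Vec as Vec using (Vec; []; _∷_; lookup; tabulate; toList; updateAt; replicate; zipWith; map)
open import Data.Vec.Properties using (tabulate∘lookup; tabulate-cong; lookup∘tabulate; ∷-injective)
open import Data.Vec.Relation.Binary.Pointwise.Inductive using (Pointwise; []; _∷_)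
open import Data.List as List using (List; []; _∷_; length; upTo)
open import Data.List.Relation.Unary.All as All using (All)
open import Data.List.Relation.Unary.AllPairs using (_∷_)
open import Data.List.Relation.Unary.Any as Any using (here; there)
open import Data.List.Relation.Unary.Unique.Propositional using (Unique)
open import Data.List.Membership.Propositional using (_∈_)
open import Data.List.Membership.Propositional.Properties using (∈-lookup; ∈-concatMap⁺; ∈-map⁺; ∈-upTo⁺)
open import Data.Product using (Σ-syntax; _×_; _,_; proj₁; proj₂; uncurry)
open import Relation.Nullary using (¬_; yes; no)
open import Relation.Nullary.Decidable using (¬¬-excluded-middle; decidable-stable)
open import Relation.Binary.Definitions using (tri<; tri≈; tri>)
open import Relation.Binary.PropositionalEquality as ≡ using (_≡_; _≢_; _≗_)
open import Algebra.Bundles using (CommutativeRing)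
open import Algebra.Morphism.Structures using (IsRingHomomorphism)

funToFin-cong : ∀ {m n} {f g : Fin m → Fin n} → f ≗ g → funToFin f ≡ funToFin g
funToFin-cong {zero}  _   = ≡.refl
funToFin-cong {suc m} f≗g = ≡.cong₂ combine (f≗g zero) (funToFin-cong (f≗g ∘ suc))

funToFin-injective : ∀ {m n} {f g : Fin m → Fin n} → funToFin f ≡ funToFin g → f ≗ g
funToFin-injective {f = f} {g} eq k =
  ≡.trans (≡.sym (finToFun-funToFin f k)) (≡.trans (≡.cong (λ w → finToFun w k) eq) (finToFun-funToFin g k))

finToFun-injective : ∀ {m n} {u v : Fin (m ^ n)} → finToFun {m} {n} u ≗ finToFun v → u ≡ v
finToFun-injective {m} {n} {u} {v} eq = begin
  u                         ≡⟨ funToFin-finToFin {n} {m} u ⟨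
  funToFin {n} (finToFun u) ≡⟨ funToFin-cong {n} {m} eq ⟩
  funToFin {n} (finToFun v) ≡⟨ funToFin-finToFin {n} {m} v ⟩
  v                         ∎
  where open ≡.≡-Reasoning

vecToFin : ∀ {q n} → Vec (Fin q) n → Fin (q ^ n)
vecToFin = funToFin ∘ lookup

vecToFin-injective : ∀ {q n} {u v : Vec (Fin q) n} → vecToFin u ≡ vecToFin v → u ≡ v
vecToFin-injective {u = u} {v} eq = begin
  u                   ≡⟨ tabulate∘lookup u ⟨
  tabulate (lookup u) ≡⟨ tabulate-cong (funToFin-injective eq) ⟩
  tabulate (lookup v) ≡⟨ tabulate∘lookup v ⟩
  v                   ∎
  where open ≡.≡-Reasoning

finToVec : ∀ {q n} → Fin (q ^ n) → Vec (Fin q) n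
finToVec = tabulate ∘ finToFun

finToVec-injective : ∀ {q n} {u v : Fin (q ^ n)} → finToVec {q} {n} u ≡ finToVec v → u ≡ v
finToVec-injective {q} {n} {u} {v} eq = finToFun-injective {q} {n} λ k →
  ≡.trans (≡.sym (lookup∘tabulate (finToFun u) k))
          (≡.trans (≡.cong (λ w → lookup w k) eq) (lookup∘tabulate (finToFun v) k))

×-injective⇒≤ : ∀ {a b n} (g : Fin a → Fin b → Fin n) →
                (∀ {i j i′ j′} → g i j ≡ g i′ j′ → i ≡ i′ × j ≡ j′) → a ℕ.* b ≤ n
×-injective⇒≤ {a} {b} g g-injective = injective⇒≤ λ {z} {z′} eq → begin
  z                                  ≡⟨ combine-remQuot {a} b z ⟨
  uncurry combine (remQuot {a} b z)  ≡⟨ ≡.cong (uncurry combine) (pair-injective _ _ eq) ⟩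
  uncurry combine (remQuot {a} b z′) ≡⟨ combine-remQuot {a} b z′ ⟩
  z′                                 ∎
  where
  open ≡.≡-Reasoning
  pair-injective : ∀ s s′ → uncurry g s ≡ uncurry g s′ → s ≡ s′
  pair-injective (i , j) (i′ , j′) eq with g-injective eq
  ... | ≡.refl , ≡.refl = ≡.refl

pairs : ℕ → ℕ
pairs zero    = 0
pairs (suc m) = m ℕ.+ pairs m

pairs≡C₂ : ∀ m → pairs m ≡ m C 2
pairs≡C₂ zero    = ≡.refl
pairs≡C₂ (suc m) = ≡.trans (≡.cong₂ ℕ._+_ (≡.sym (nC1≡n m)) (pairs≡C₂ m)) (nCk+nC[k+1]≡[n+1]C[k+1] m 1)

pairIndex : ∀ {m} {i j : Fin m} → i Fin.< j → Fin (pairs m)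
pairIndex {suc m} {zero}  {suc j} _         = j ↑ˡ pairs m
pairIndex {suc m} {suc i} {suc j} (s≤s i<j) = m ↑ʳ pairIndex i<j

↑ˡ≢↑ʳ : ∀ {m n} (i : Fin m) (j : Fin n) → i ↑ˡ n ≢ m ↑ʳ j
↑ˡ≢↑ʳ {m} {n} i j eq with ≡.trans (≡.sym (splitAt-↑ˡ m i n)) (≡.trans (≡.cong (splitAt m) eq) (splitAt-↑ʳ m n j))
... | ()

pairIndex-injective : ∀ {m} {i j i′ j′ : Fin m} (p : i Fin.< j) (p′ : i′ Fin.< j′) →
                      pairIndex p ≡ pairIndex p′ → i ≡ i′ × j ≡ j′
pairIndex-injective {suc m} {zero}  {suc j} {zero}   {suc j′} _ _ eq =
  ≡.refl , ≡.cong suc (↑ˡ-injective (pairs m) j j′ eq)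
pairIndex-injective {suc m} {zero}  {suc j} {suc i′} {suc j′} _ (s≤s _) eq = ⊥-elim (↑ˡ≢↑ʳ j _ eq)
pairIndex-injective {suc m} {suc i} {suc j} {zero}   {suc j′} (s≤s _) _ eq = ⊥-elim (↑ˡ≢↑ʳ j′ _ (≡.sym eq))
pairIndex-injective {suc m} {suc i} {suc j} {suc i′} {suc j′} (s≤s p) (s≤s p′) eq
  with pairIndex-injective p p′ (↑ʳ-injective m _ _ eq)
... | ≡.refl , ≡.refl = ≡.refl , ≡.refl

q^[1+t]≰a*q^t : ∀ {a q} t → a ℕ.< q → ¬ (q ^ suc t ≤ a ℕ.* q ^ t)
q^[1+t]≰a*q^t {a} {q} t a<q = <⇒≱ (*-monoˡ-< (q ^ t) {{m^n≢0 q t {{>-nonZero (≤-<-trans z≤n a<q)}}}} a<q)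

monomials-complete : ∀ t d (e : Vec ℕ t) → Vec.sum e ≤ d → e ∈ monomials t d
monomials-complete zero    d []       _      = here ≡.refl
monomials-complete (suc t) d (a ∷ e) deg≤d =
  ∈-concatMap⁺ (λ b → List.map (b ∷_) (monomials t (d ∸ b))) (Any.map (λ { ≡.refl → e∈ }) a∈)
  where
  a∈ : a ∈ upTo (suc d)
  a∈ = ∈-upTo⁺ (s≤s (≤-trans (m≤m+n a (Vec.sum e)) deg≤d))
  e∈ : a ∷ e ∈ List.map (a ∷_) (monomials t (d ∸ a))
  e∈ = ∈-map⁺ (a ∷_) (monomials-complete t (d ∸ a) e (≡.subst (_≤ d ∸ a) (m+n∸m≡n a (Vec.sum e)) (∸-monoˡ-≤ a deg≤d)))

sum-updateAt-suc : ∀ {t} (e : Vec ℕ t) k → Vec.sum (updateAt e k suc) ≡ suc (Vec.sum e)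
sum-updateAt-suc (a ∷ e) zero    = ≡.refl
sum-updateAt-suc (a ∷ e) (suc k) = ≡.trans (≡.cong (a ℕ.+_) (sum-updateAt-suc e k)) (+-suc a (Vec.sum e))

sum-replicate-zero : ∀ t → Vec.sum (replicate t 0) ≡ 0
sum-replicate-zero zero    = ≡.refl
sum-replicate-zero (suc t) = sum-replicate-zero t

lookup-injective : ∀ {a} {A : Set a} {xs : List A} → Unique xs → ∀ i j → List.lookup xs i ≡ List.lookup xs j → i ≡ j
lookup-injective (_ ∷ _)      zero    zero    _  = ≡.refl
lookup-injective (x≢ ∷ _)     zero    (suc j) eq = ⊥-elim (All.lookup x≢ (∈-lookup j) eq)
lookup-injective (x≢ ∷ _)     (suc i) zero    eq = ⊥-elim (All.lookup x≢ (∈-lookup i) (≡.sym eq))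
lookup-injective (_ ∷ unique) (suc i) (suc j) eq = ≡.cong suc (lookup-injective unique i j eq)

punchIn-agree⇒≗ : ∀ {a} {A : Set a} {n} (f g : Fin (suc n) → A) k →
                  (∀ r → f (punchIn k r) ≡ g (punchIn k r)) → f k ≡ g k → f ≗ g
punchIn-agree⇒≗ f g k agree fk≡gk j with k Fin.≟ j
... | yes ≡.refl = fk≡gk
... | no  k≢j    = ≡.subst (λ s → f s ≡ g s) (punchIn-punchOut k≢j) (agree (punchOut k≢j))

¬¬-Π : ∀ {p} n {P : Fin n → Set p} → (∀ i → ¬ ¬ P i) → ¬ ¬ (∀ i → P i)
¬¬-Π zero    _    ¬∀ = ¬∀ λ ()
¬¬-Π (suc n) ¬¬P ¬∀ = ¬¬P zero λ P₀ → ¬¬-Π n (¬¬P ∘ suc) λ P₊ → ¬∀ λ { zero → P₀ ; (suc i) → P₊ i }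

module Univariate {c ℓ} (K : CommutativeRing c ℓ) where
  open CommutativeRing K hiding (zero)
  open import Relation.Binary.Reasoning.Setoid setoid
  open import Algebra.Solver.Ring.NaturalCoefficients.Default commutativeSemiring
  open import Algebra.Properties.Group +-group using (∙-cancelʳ; x∙y⁻¹≈ε⇒x≈y; //-rightDividesˡ)

  Distinct : ∀ {n} → (Fin n → Carrier) → Set ℓ
  Distinct ys = ∀ i j → i ≢ j → ¬ ys i ≈ ys j

  horner : ∀ {n} → Vec Carrier n → Carrier → Carrier
  horner as = hornerEval K (toList as)

  horner-cong : ∀ {n} {as bs : Vec Carrier n} → Pointwise _≈_ as bs → ∀ y → horner as y ≈ horner bs y
  horner-cong []              y = refl
  horner-cong (a≈b ∷ as≈bs) y = +-cong a≈b (*-congˡ (horner-cong as≈bs y))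

  horner-∷-cancel : ∀ {n a b} {as bs : Vec Carrier n} z →
                    Pointwise _≈_ as bs → horner (a ∷ as) z ≈ horner (b ∷ bs) z → a ≈ b
  horner-∷-cancel {a = a} {b} {as} {bs} z as≈bs eq = ∙-cancelʳ (z * horner bs z) a b (begin
    a + z * horner bs z ≈⟨ +-congˡ (*-congˡ (horner-cong as≈bs z)) ⟨
    a + z * horner as z ≈⟨ eq ⟩
    b + z * horner bs z ∎)

  -- The quotient of  a ∷ as  by  X - z; it does not depend on the constant term a.
  deflate : ∀ {n} → Carrier → Vec Carrier n → Vec Carrier n
  deflate z []       = []
  deflate z (b ∷ bs) = horner (b ∷ bs) z ∷ deflate z bs

  -- p(y) - p(z) = (y - z) q(y), with both sides moved so that no subtraction occurs.
  horner-deflate : ∀ {n} z a (as : Vec Carrier n) y →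
    horner (a ∷ as) y + z * horner (deflate z as) y ≈ y * horner (deflate z as) y + horner (a ∷ as) z
  horner-deflate z a [] y =
    solve 4 (λ a y z o → (a :+ y :* o) :+ z :* o := y :* o :+ (a :+ z :* o)) refl a y z 0#
  horner-deflate z a (b ∷ bs) y = begin
    (a + y * p) + z * (r + y * w) ≈⟨ solve 6 (λ a y z p r w → (a :+ y :* p) :+ z :* (r :+ y :* w) := (a :+ z :* r) :+ y :* (p :+ z :* w)) refl a y z p r w ⟩
    (a + z * r) + y * (p + z * w) ≈⟨ +-congˡ (*-congˡ (horner-deflate z b bs y)) ⟩
    (a + z * r) + y * (y * w + r) ≈⟨ solve 5 (λ a y z r w → (a :+ z :* r) :+ y :* (y :* w :+ r) := y :* (r :+ y :* w) :+ (a :+ z :* r)) refl a y z r w ⟩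
    y * (r + y * w) + (a + z * r) ∎
    where
    p = horner (b ∷ bs) y
    r = horner (b ∷ bs) z
    w = horner (deflate z bs) y

  deflate-injective : ∀ {n} z {as bs : Vec Carrier n} →
                      Pointwise _≈_ (deflate z as) (deflate z bs) → Pointwise _≈_ as bs
  deflate-injective z {[]}     {[]}     []        = []
  deflate-injective z {a ∷ as} {b ∷ bs} (h ∷ hs) = horner-∷-cancel z as≈bs h ∷ as≈bs
    where as≈bs = deflate-injective z hs

  module _ (isField : IsField K) where

    cross-cancel : ∀ {a b u v} → ¬ u ≈ v → a * u + b * v ≈ a * v + b * u → a ≈ b
    cross-cancel {a} {b} {u} {v} u≉v eq = x∙y⁻¹≈ε⇒x≈y a b d≈0
      where
      d = a - b
      e = u - v
      split : ∀ x y → x ≈ (x - y) + y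
      split x y = sym (//-rightDividesˡ y x)
      de≈0 : d * e ≈ 0#
      de≈0 = ∙-cancelʳ (a * v + b * u) (d * e) 0# (begin
        d * e + (a * v + b * u)             ≈⟨ +-congˡ (+-cong (*-congʳ (split a b)) (*-congˡ (split u v))) ⟩
        d * e + ((d + b) * v + b * (e + v)) ≈⟨ solve 4 (λ d e b v → d :* e :+ ((d :+ b) :* v :+ b :* (e :+ v)) := (d :+ b) :* (e :+ v) :+ b :* v) refl d e b v ⟩
        (d + b) * (e + v) + b * v           ≈⟨ +-congʳ (*-cong (split a b) (split u v)) ⟨
        a * u + b * v                       ≈⟨ eq ⟩
        a * v + b * u                       ≈⟨ +-identityˡ _ ⟨
        0# + (a * v + b * u)                ∎)
      d≈0 : d ≈ 0#
      d≈0 with proj₂ isField e (λ e≈0 → u≉v (x∙y⁻¹≈ε⇒x≈y u v e≈0))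
      ... | e⁻¹ , ee⁻¹≈1 = begin
        d                ≈⟨ *-identityʳ d ⟨
        d * 1#           ≈⟨ *-congˡ ee⁻¹≈1 ⟨
        d * (e * e⁻¹)    ≈⟨ *-assoc d e e⁻¹ ⟨
        (d * e) * e⁻¹    ≈⟨ *-congʳ de≈0 ⟩
        0# * e⁻¹         ≈⟨ zeroˡ e⁻¹ ⟩
        0#               ∎

    horner-agree⇒≋ : ∀ {n} (as bs : Vec Carrier n) {ys : Fin n → Carrier} → Distinct ys →
                     (∀ i → horner as (ys i) ≈ horner bs (ys i)) → Pointwise _≈_ as bs
    horner-agree⇒≋ []       []       _        _     = []
    horner-agree⇒≋ (a ∷ as) (b ∷ bs) {ys} distinct agree = horner-∷-cancel z as≈bs (agree zero) ∷ as≈bs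
      where
      z = ys zero
      quotients-agree : ∀ i → horner (deflate z as) (ys (suc i)) ≈ horner (deflate z bs) (ys (suc i))
      quotients-agree i = cross-cancel (distinct (suc i) zero λ ()) (∙-cancelʳ (p + r) _ _ (begin
        (A * y + B * z) + (p + r) ≈⟨ solve 6 (λ A B y z p r → (A :* y :+ B :* z) :+ (p :+ r) := (y :* A :+ r) :+ (p :+ z :* B)) refl A B y z p r ⟩
        (y * A + r) + (p + z * B) ≈⟨ +-cong (sym (horner-deflate z a as y)) quotient-b ⟩
        (p + z * A) + (y * B + r) ≈⟨ solve 6 (λ A B y z p r → (p :+ z :* A) :+ (y :* B :+ r) := (A :* z :+ B :* y) :+ (p :+ r)) refl A B y z p r ⟩
        (A * z + B * y) + (p + r) ∎))
        where
        y = ys (suc i)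
        A = horner (deflate z as) y
        B = horner (deflate z bs) y
        p = horner (a ∷ as) y
        r = horner (a ∷ as) z
        quotient-b : p + z * B ≈ y * B + r
        quotient-b = begin
          p + z * B                  ≈⟨ +-congʳ (agree (suc i)) ⟩
          horner (b ∷ bs) y + z * B  ≈⟨ horner-deflate z b bs y ⟩
          y * B + horner (b ∷ bs) z  ≈⟨ +-congˡ (agree zero) ⟨
          y * B + r                  ∎
      as≈bs : Pointwise _≈_ as bs
      as≈bs = deflate-injective z (horner-agree⇒≋ (deflate z as) (deflate z bs)
        (λ i j i≢j → distinct (suc i) (suc j) (λ eq → i≢j (suc-injective eq))) quotients-agree)

module Evaluation {q c ℓ} (F : FiniteField q) (K : CommutativeRing c ℓ)
                 (ι : Fin q → CommutativeRing.Carrier K)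
                 (ι-hom : IsRingHomomorphism (CommutativeRing.rawRing (FiniteField.ring F))
                                             (CommutativeRing.rawRing K) ι) where
  module 𝔽 = CommutativeRing (FiniteField.ring F)
  open CommutativeRing K hiding (zero)
  open IsRingHomomorphism ι-hom using (+-homo; *-homo; 0#-homo; 1#-homo; -‿homo)
  open Univariate K using (horner)
  open import Relation.Binary.Reasoning.Setoid setoid
  open import Algebra.Solver.Ring.NaturalCoefficients.Default commutativeSemiring
  open import Algebra.Properties.CommutativeSemigroup *-commutativeSemigroup using (x∙yz≈y∙xz)
  open import Algebra.Properties.Group +-group using (x≈y⇒x∙y⁻¹≈ε)
  open import Algebra.Properties.Group 𝔽.+-group
    using () renaming (x∙y⁻¹≈ε⇒x≈y to 𝔽-x∙y⁻¹≈ε⇒x≈y; ∙-cancelʳ to 𝔽-∙-cancelʳ)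
  open import Algebra.Properties.Semiring.Sum semiring
    using (sum-syntax; sum-cong-≋; *-distribˡ-sum; *-distribʳ-sum)

  ι-injective : ¬ 1# ≈ 0# → Injective _≡_ _≈_ ι
  ι-injective 1≉0 {a} {b} ιa≈ιb with a 𝔽.- b Fin.≟ 𝔽.0#
  ... | yes a-b≡0 = 𝔽-x∙y⁻¹≈ε⇒x≈y a b a-b≡0
  ... | no  a-b≢0 with proj₂ (FiniteField.isField F) (a 𝔽.- b) a-b≢0
  ...   | e , [a-b]e≡1 = ⊥-elim (1≉0 (begin
    1#                    ≈⟨ 1#-homo ⟨
    ι 𝔽.1#                ≡⟨ ≡.cong ι [a-b]e≡1 ⟨
    ι ((a 𝔽.- b) 𝔽.* e)   ≈⟨ *-homo (a 𝔽.- b) e ⟩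
    ι (a 𝔽.- b) * ι e     ≈⟨ *-congʳ (trans (+-homo a (𝔽.- b)) (+-congˡ (-‿homo b))) ⟩
    (ι a - ι b) * ι e     ≈⟨ *-congʳ (x≈y⇒x∙y⁻¹≈ε ιa≈ιb) ⟩
    0# * ι e              ≈⟨ zeroˡ (ι e) ⟩
    0#                    ∎))

  ι-map-injective : ¬ 1# ≈ 0# → ∀ {n} {u v : Vec (Fin q) n} → Pointwise _≈_ (map ι u) (map ι v) → u ≡ v
  ι-map-injective 1≉0 {u = []}    {[]}    []        = ≡.refl
  ι-map-injective 1≉0 {u = a ∷ u} {b ∷ v} (ιa≈ιb ∷ eq) = ≡.cong₂ _∷_ (ι-injective 1≉0 ιa≈ιb) (ι-map-injective 1≉0 eq)

  0ᶜ : ∀ {n} → Vec (Fin q) n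
  0ᶜ = replicate _ 𝔽.0#

  _+ᶜ_ : ∀ {n} → Vec (Fin q) n → Vec (Fin q) n → Vec (Fin q) n
  _+ᶜ_ = zipWith 𝔽._+_

  +ᶜ-cancelʳ : ∀ {n} (u v w : Vec (Fin q) n) → u +ᶜ w ≡ v +ᶜ w → u ≡ v
  +ᶜ-cancelʳ []      []      []      _  = ≡.refl
  +ᶜ-cancelʳ (a ∷ u) (b ∷ v) (c ∷ w) eq with ∷-injective eq
  ... | a+c≡b+c , rest = ≡.cong₂ _∷_ (𝔽-∙-cancelʳ c a b a+c≡b+c) (+ᶜ-cancelʳ u v w rest)

  _·ᶜ_ : ∀ {n} → Fin q → Vec (Fin q) n → Vec (Fin q) n
  a ·ᶜ cs = map (a 𝔽.*_) cs

  unitᶜ : ∀ {t} {ms : List (Vec ℕ t)} {e} → e ∈ ms → Vec (Fin q) (length ms)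
  unitᶜ {ms = _ ∷ _} (here _)  = 𝔽.1# ∷ 0ᶜ
  unitᶜ {ms = _ ∷ _} (there p) = 𝔽.0# ∷ unitᶜ p

  module _ {t} (x : Fin t → Carrier) where

    evalList-0ᶜ : ∀ ms → evalList K ι ms 0ᶜ x ≈ 0#
    evalList-0ᶜ []       = refl
    evalList-0ᶜ (e ∷ ms) = begin
      ι 𝔽.0# * monomialEval K e x + evalList K ι ms 0ᶜ x ≈⟨ +-cong (*-congʳ 0#-homo) (evalList-0ᶜ ms) ⟩
      0# * monomialEval K e x + 0#                       ≈⟨ +-identityʳ _ ⟩
      0# * monomialEval K e x                            ≈⟨ zeroˡ _ ⟩
      0#                                                 ∎

    evalList-+ᶜ : ∀ ms u v → evalList K ι ms (u +ᶜ v) x ≈ evalList K ι ms u x + evalList K ι ms v x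
    evalList-+ᶜ []       []      []      = sym (+-identityʳ 0#)
    evalList-+ᶜ (e ∷ ms) (a ∷ u) (b ∷ v) = begin
      ι (a 𝔽.+ b) * m + evalList K ι ms (u +ᶜ v) x ≈⟨ +-cong (*-congʳ (+-homo a b)) (evalList-+ᶜ ms u v) ⟩
      (ι a + ι b) * m + (U + V)                   ≈⟨ solve 5 (λ a b m U V → (a :+ b) :* m :+ (U :+ V) := (a :* m :+ U) :+ (b :* m :+ V)) refl (ι a) (ι b) m U V ⟩
      (ι a * m + U) + (ι b * m + V)               ∎
      where
      m = monomialEval K e x
      U = evalList K ι ms u x
      V = evalList K ι ms v x

    evalList-·ᶜ : ∀ ms a u → evalList K ι ms (a ·ᶜ u) x ≈ ι a * evalList K ι ms u x
    evalList-·ᶜ []       a []      = sym (zeroʳ (ι a))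
    evalList-·ᶜ (e ∷ ms) a (b ∷ u) = begin
      ι (a 𝔽.* b) * m + evalList K ι ms (a ·ᶜ u) x ≈⟨ +-cong (*-congʳ (*-homo a b)) (evalList-·ᶜ ms a u) ⟩
      (ι a * ι b) * m + ι a * U                   ≈⟨ solve 4 (λ a b m U → (a :* b) :* m :+ a :* U := a :* (b :* m :+ U)) refl (ι a) (ι b) m U ⟩
      ι a * (ι b * m + U)                         ∎
      where
      m = monomialEval K e x
      U = evalList K ι ms u x

    evalList-unitᶜ : ∀ {ms e} (p : e ∈ ms) → evalList K ι ms (unitᶜ p) x ≈ monomialEval K e x
    evalList-unitᶜ {_ ∷ ms} (here ≡.refl) = begin
      ι 𝔽.1# * _ + evalList K ι ms 0ᶜ x ≈⟨ +-cong (*-congʳ 1#-homo) (evalList-0ᶜ ms) ⟩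
      1# * _ + 0#                        ≈⟨ +-identityʳ _ ⟩
      1# * _                             ≈⟨ *-identityˡ _ ⟩
      _                                  ∎
    evalList-unitᶜ {e′ ∷ ms} (there p) = begin
      ι 𝔽.0# * monomialEval K e′ x + evalList K ι ms (unitᶜ p) x ≈⟨ +-cong (*-congʳ 0#-homo) (evalList-unitᶜ p) ⟩
      0# * monomialEval K e′ x + _                                ≈⟨ +-congʳ (zeroˡ _) ⟩
      0# + _                                                      ≈⟨ +-identityˡ _ ⟩
      _                                                           ∎

  Representable : ∀ t → ℕ → ((Fin t → Carrier) → Carrier) → Set (c ⊔ ℓ)
  Representable t d g = Σ[ f ∈ Poly q t d ] (∀ x → evalPoly K ι f x ≈ g x)

  module _ {t d : ℕ} where

    rep-cong : ∀ {g h} → (∀ x → g x ≈ h x) → Representable t d g → Representable t d h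
    rep-cong g≈h (f , eval-f) = f , λ x → trans (eval-f x) (g≈h x)

    rep-0 : Representable t d (λ _ → 0#)
    rep-0 = 0ᶜ , λ x → evalList-0ᶜ x (monomials t d)

    rep-+ : ∀ {g h} → Representable t d g → Representable t d h → Representable t d (λ x → g x + h x)
    rep-+ (f , eval-f) (f′ , eval-f′) =
      f +ᶜ f′ , λ x → trans (evalList-+ᶜ x (monomials t d) f f′) (+-cong (eval-f x) (eval-f′ x))

    rep-· : ∀ {g} a → Representable t d g → Representable t d (λ x → ι a * g x)
    rep-· a (f , eval-f) = a ·ᶜ f , λ x → trans (evalList-·ᶜ x (monomials t d) a f) (*-congˡ (eval-f x))

    rep-∑ : ∀ {n} {g : Fin n → (Fin t → Carrier) → Carrier} →
            (∀ k → Representable t d (g k)) → Representable t d (λ x → ∑[ k < n ] g k x)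
    rep-∑ {zero}  _   = rep-0
    rep-∑ {suc n} rep = rep-+ (rep zero) (rep-∑ (rep ∘ suc))

    rep-monomial : ∀ e → Vec.sum e ≤ d → Representable t d (monomialEval K e)
    rep-monomial e deg≤d = unitᶜ e∈ , λ x → evalList-unitᶜ x e∈
      where e∈ = monomials-complete t d e deg≤d

  monomialEval-updateAt : ∀ {t} (e : Vec ℕ t) k x → monomialEval K (updateAt e k suc) x ≈ x k * monomialEval K e x
  monomialEval-updateAt (a ∷ e) zero    x = *-assoc (x zero) _ _
  monomialEval-updateAt (a ∷ e) (suc k) x = begin
    p * monomialEval K (updateAt e k suc) (x ∘ suc) ≈⟨ *-congˡ (monomialEval-updateAt e k (x ∘ suc)) ⟩
    p * (x (suc k) * monomialEval K e (x ∘ suc))   ≈⟨ x∙yz≈y∙xz p _ _ ⟩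
    x (suc k) * (p * monomialEval K e (x ∘ suc))   ∎
    where p = _^ᴷ_ K (x zero) a

  monomialEval-zeros : ∀ t x → monomialEval K (replicate t 0) x ≈ 1#
  monomialEval-zeros zero    x = refl
  monomialEval-zeros (suc t) x = trans (*-identityˡ _) (monomialEval-zeros t (x ∘ suc))

  linearForm : ∀ {t} → (Fin t → Fin q) → (Fin t → Carrier) → Carrier
  linearForm {t} l x = ∑[ k < t ] (ι (l k) * x k)

  monomial*linearForm : ∀ {t} (l : Fin t → Fin q) e x →
    monomialEval K e x * linearForm l x ≈ ∑[ k < t ] (ι (l k) * monomialEval K (updateAt e k suc) x)
  monomial*linearForm {t} l e x = trans (*-distribˡ-sum {t} _ _) (sum-cong-≋ {t} λ k → begin
    m * (ι (l k) * x k)    ≈⟨ x∙yz≈y∙xz m _ _ ⟩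
    ι (l k) * (m * x k)    ≈⟨ *-congˡ (trans (*-comm m (x k)) (sym (monomialEval-updateAt e k x))) ⟩
    ι (l k) * monomialEval K (updateAt e k suc) x ∎)
    where m = monomialEval K e x

  rep-monomial*horner : ∀ {t d n} (l : Fin t → Fin q) (cs : Vec (Fin q) n) e → Vec.sum e ℕ.+ n ≤ suc d →
    Representable t d (λ x → monomialEval K e x * horner (map ι cs) (linearForm l x))
  rep-monomial*horner l [] e _ = rep-cong (λ x → sym (zeroʳ _)) rep-0
  rep-monomial*horner {t} {d} {suc n} l (c ∷ cs) e deg≤ =
    rep-cong expand (rep-+ (rep-· c (rep-monomial e deg-e))
                           (rep-∑ λ k → rep-· (l k) (rep-monomial*horner l cs (updateAt e k suc) (deg-shift k))))
    where
    deg≤′ : suc (Vec.sum e ℕ.+ n) ≤ suc d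
    deg≤′ = ≡.subst (_≤ suc d) (+-suc (Vec.sum e) n) deg≤
    deg-e : Vec.sum e ≤ d
    deg-e = ≤-trans (m≤m+n _ n) (≤-pred deg≤′)
    deg-shift : ∀ k → Vec.sum (updateAt e k suc) ℕ.+ n ≤ suc d
    deg-shift k = ≡.subst (λ s → s ℕ.+ n ≤ suc d) (≡.sym (sum-updateAt-suc e k)) deg≤′
    expand : ∀ x → ι c * monomialEval K e x + ∑[ k < t ] (ι (l k) * (monomialEval K (updateAt e k suc) x * horner (map ι cs) (linearForm l x)))
                 ≈ monomialEval K e x * horner (map ι (c ∷ cs)) (linearForm l x)
    expand x = sym (begin
      m * (ι c + L * h)                             ≈⟨ solve 4 (λ m γ L h → m :* (γ :+ L :* h) := γ :* m :+ (m :* L) :* h) refl m (ι c) L h ⟩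
      ι c * m + (m * L) * h                         ≈⟨ +-congˡ (*-congʳ (monomial*linearForm l e x)) ⟩
      ι c * m + (∑[ k < t ] (ι (l k) * m′ k)) * h    ≈⟨ +-congˡ (*-distribʳ-sum {t} h _) ⟩
      ι c * m + ∑[ k < t ] ((ι (l k) * m′ k) * h)    ≈⟨ +-congˡ (sum-cong-≋ {t} λ k → *-assoc _ _ h) ⟩
      ι c * m + ∑[ k < t ] (ι (l k) * (m′ k * h))    ∎)
      where
      m = monomialEval K e x
      L = linearForm l x
      h = horner (map ι cs) L
      m′ = λ k → monomialEval K (updateAt e k suc) x

  rep-horner∘linearForm : ∀ {t d n} (l : Fin t → Fin q) (cs : Vec (Fin q) n) → n ≤ suc d →
    Representable t d (λ x → horner (map ι cs) (linearForm l x))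
  rep-horner∘linearForm {t} {d} {n} l cs n≤ =
    rep-cong (λ x → trans (*-congʳ (monomialEval-zeros t x)) (*-identityˡ _))
             (rep-monomial*horner l cs (replicate t 0) (≡.subst (λ s → s ℕ.+ n ≤ suc d) (≡.sym (sum-replicate-zero t)) n≤))

module SeparatingForm {q c ℓ} (F : FiniteField q) (K : CommutativeRing c ℓ)
                      (ι : Fin q → CommutativeRing.Carrier K)
                      (ι-hom : IsRingHomomorphism (CommutativeRing.rawRing (FiniteField.ring F))
                                                  (CommutativeRing.rawRing K) ι)
                      (K-field : IsField K) where
  open CommutativeRing K hiding (zero)
  open Evaluation F K ι ι-hom
  open Univariate K using (Distinct; cross-cancel)
  open import Relation.Binary.Reasoning.Setoid setoid
  open import Algebra.Solver.Ring.NaturalCoefficients.Default commutativeSemiring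
  open import Algebra.Properties.Semiring.Sum semiring using (sum-syntax; sum-remove; sum-cong-≋)
  open import Algebra.Properties.Group +-group using (∙-cancelʳ)

  coefficient-determined : ∀ {t} (l l′ : Fin (suc t) → Fin q) k (y y′ : Fin (suc t) → Carrier) →
    ¬ y k ≈ y′ k → (∀ r → l (punchIn k r) ≡ l′ (punchIn k r)) →
    linearForm l y ≈ linearForm l y′ → linearForm l′ y ≈ linearForm l′ y′ → l k ≡ l′ k
  coefficient-determined {t} l l′ k y y′ yk≉y′k agree eq eq′ =
    ι-injective (proj₁ K-field) (cross-cancel K-field yk≉y′k (∙-cancelʳ (R + R′) _ _ (begin
      (a * u + a′ * v) + (R + R′) ≈⟨ solve 6 (λ a a′ u v R R′ → (a :* u :+ a′ :* v) :+ (R :+ R′) := (a :* u :+ R) :+ (a′ :* v :+ R′)) refl a a′ u v R R′ ⟩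
      (a * u + R) + (a′ * v + R′) ≈⟨ +-cong h (sym h′) ⟩
      (a * v + R′) + (a′ * u + R) ≈⟨ solve 6 (λ a a′ u v R R′ → (a :* v :+ R′) :+ (a′ :* u :+ R) := (a :* v :+ a′ :* u) :+ (R :+ R′)) refl a a′ u v R R′ ⟩
      (a * v + a′ * u) + (R + R′) ∎)))
    where
    a = ι (l k)
    a′ = ι (l′ k)
    u = y k
    v = y′ k
    rest : (Fin (suc t) → Carrier) → Carrier
    rest z = ∑[ r < t ] (ι (l (punchIn k r)) * z (punchIn k r))
    R = rest y
    R′ = rest y′
    rest-agree : ∀ z → ∑[ r < t ] (ι (l′ (punchIn k r)) * z (punchIn k r)) ≈ rest z
    rest-agree z = sum-cong-≋ {t} λ r → *-congʳ (reflexive (≡.cong ι (≡.sym (agree r))))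
    removed : ∀ l″ z → linearForm l″ z ≈ ι (l″ k) * z k + ∑[ r < t ] (ι (l″ (punchIn k r)) * z (punchIn k r))
    removed l″ z = sum-remove {t} {k} (λ j → ι (l″ j) * z j)
    h : a * u + R ≈ a * v + R′
    h = trans (sym (removed l y)) (trans eq (removed l y′))
    h′ : a′ * u + R ≈ a′ * v + R′
    h′ = trans (+-congˡ (sym (rest-agree y)))
               (trans (sym (removed l′ y)) (trans eq′ (trans (removed l′ y′) (+-congˡ (rest-agree y′)))))

  module _ {m t} (x : Fin m → Fin (suc t) → Carrier)
           (x-distinct : ∀ i j → i ≢ j → ¬ (∀ k → x i k ≈ x j k)) where

    Separates : (Fin (suc t) → Fin q) → Set ℓ
    Separates l = Distinct (λ i → linearForm l (x i))

    Collision : (Fin (suc t) → Fin q) → Set ℓ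
    Collision l = Σ[ i ∈ Fin m ] Σ[ j ∈ Fin m ] i Fin.< j × linearForm l (x i) ≈ linearForm l (x j)

    ¬collision⇒separates : ∀ l → ¬ Collision l → Separates l
    ¬collision⇒separates l ¬col i j i≢j eq with <-cmp i j
    ... | tri< i<j _   _   = ¬col (i , j , i<j , eq)
    ... | tri≈ _   i≡j _   = i≢j i≡j
    ... | tri> _   _   j<i = ¬col (j , i , j<i , sym eq)

    DifferingCoordinates : Set ℓ
    DifferingCoordinates = ∀ i j → i Fin.< j → Σ[ k ∈ Fin (suc t) ] ¬ x i k ≈ x j k

    -- Equality in K is not decidable, but excluded middle for the finitely many
    -- instances needed holds under a double negation.
    ¬¬-differingCoordinates : ¬ ¬ DifferingCoordinates
    ¬¬-differingCoordinates = ¬¬-Π m λ i → ¬¬-Π m λ j → differing i j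
      where
      differing : ∀ i j → ¬ ¬ (i Fin.< j → Σ[ k ∈ Fin (suc t) ] ¬ x i k ≈ x j k)
      differing i j ¬d = ¬¬-Π (suc t) (λ _ → ¬¬-excluded-middle) λ dec →
        ¬d λ i<j → ¬∀⟶∃¬ (suc t) _ dec (x-distinct i j (<⇒≢ i<j))

    module _ (differs : DifferingCoordinates) where

      encode : ∀ l → Collision l → Fin (pairs m ℕ.* q ^ t)
      encode l (i , j , i<j , _) = combine (pairIndex i<j) (funToFin (l ∘ punchIn (proj₁ (differs i j i<j))))

      encode-injective : ∀ {l l′} (col : Collision l) (col′ : Collision l′) → encode l col ≡ encode l′ col′ → l ≗ l′
      encode-injective {l} {l′} (i , j , i<j , eq) (_ , _ , i<j′ , eq′) same
        with combine-injective _ _ _ _ same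
      ... | same-pair , same-rest with pairIndex-injective i<j i<j′ same-pair
      ... | ≡.refl , ≡.refl with <-irrelevant i<j i<j′
      ... | ≡.refl = punchIn-agree⇒≗ l l′ k off-k (coefficient-determined l l′ k (x i) (x j) (proj₂ (differs i j i<j)) off-k eq eq′)
        where
        k = proj₁ (differs i j i<j)
        off-k : ∀ r → l (punchIn k r) ≡ l′ (punchIn k r)
        off-k = funToFin-injective same-rest

    ¬¬-separatingForm : pairs m ℕ.< q → ¬ ¬ (Σ[ l ∈ (Fin (suc t) → Fin q) ] Separates l)
    ¬¬-separatingForm pairs<q ¬sep =
      ¬¬-Π (q ^ suc t) (λ u ¬col → ¬sep (finToFun u , ¬collision⇒separates (finToFun u) ¬col)) λ collides →
      ¬¬-differingCoordinates λ differs →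
      q^[1+t]≰a*q^t t pairs<q (injective⇒≤ λ same →
        finToFun-injective (encode-injective differs (collides _) (collides _) same))

module Counting {q c ℓ} (F : FiniteField q) (K : CommutativeRing c ℓ)
                (ι : Fin q → CommutativeRing.Carrier K)
                (ι-hom : IsRingHomomorphism (CommutativeRing.rawRing (FiniteField.ring F))
                                            (CommutativeRing.rawRing K) ι)
                (K-field : IsField K) where
  open CommutativeRing K hiding (zero)
  open Evaluation F K ι ι-hom
  open Univariate K using (Distinct; horner; horner-agree⇒≋)
  open import Relation.Binary.Reasoning.Setoid setoid

  module _ {m t d} (m≤1+d : m ≤ suc d) (x : Fin m → Fin t → Carrier)
           (l : Fin t → Fin q) (separates : Distinct (λ i → linearForm l (x i))) where

    VanishesOnPoints : Poly q t d → Set ℓ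
    VanishesOnPoints f = ∀ i → evalPoly K ι f (x i) ≈ 0#

    pullback : Vec (Fin q) m → Poly q t d
    pullback cs = proj₁ (rep-horner∘linearForm l cs m≤1+d)

    evalPoly-shift : ∀ {f} → VanishesOnPoints f → ∀ cs i →
                 evalPoly K ι (f +ᶜ pullback cs) (x i) ≈ horner (map ι cs) (linearForm l (x i))
    evalPoly-shift {f} f-vanishes cs i = begin
      evalPoly K ι (f +ᶜ pullback cs) (x i)                   ≈⟨ evalList-+ᶜ (x i) (monomials t d) f (pullback cs) ⟩
      evalPoly K ι f (x i) + evalPoly K ι (pullback cs) (x i) ≈⟨ +-cong (f-vanishes i) (proj₂ (rep-horner∘linearForm l cs m≤1+d) (x i)) ⟩
      0# + horner (map ι cs) (linearForm l (x i))             ≈⟨ +-identityˡ _ ⟩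
      horner (map ι cs) (linearForm l (x i))                  ∎

    shift-injective : ∀ {f f′ cs cs′} → VanishesOnPoints f → VanishesOnPoints f′ →
                      f +ᶜ pullback cs ≡ f′ +ᶜ pullback cs′ → f ≡ f′ × cs ≡ cs′
    shift-injective {f} {f′} {cs} {cs′} f-vanishes f′-vanishes same = f≡f′ , cs≡cs′
      where
      cs≡cs′ : cs ≡ cs′
      cs≡cs′ = ι-map-injective (proj₁ K-field) (horner-agree⇒≋ K-field (map ι cs) (map ι cs′) separates λ i →
        trans (sym (evalPoly-shift f-vanishes cs i))
              (trans (reflexive (≡.cong (λ g → evalPoly K ι g (x i)) same)) (evalPoly-shift f′-vanishes cs′ i)))
      f≡f′ : f ≡ f′
      f≡f′ = +ᶜ-cancelʳ f f′ (pullback cs′) (≡.subst (λ cs″ → f +ᶜ pullback cs″ ≡ _) cs≡cs′ same)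

    count : (S : List (Poly q t d)) → Unique S → All VanishesOnPoints S →
            length S ℕ.* q ^ m ≤ q ^ length (monomials t d)
    count S unique vanish = ×-injective⇒≤ (λ i u → vecToFin (List.lookup S i +ᶜ pullback (finToVec u))) λ {i} {u} {i′} {u′} same →
      let f≡f′ , cs≡cs′ = shift-injective (vanishes i) (vanishes i′) (vecToFin-injective same)
      in lookup-injective unique i i′ f≡f′ , finToVec-injective cs≡cs′
      where
      vanishes : ∀ i → VanishesOnPoints (List.lookup S i)
      vanishes i = All.lookup vanish (∈-lookup i)

open import Data.Nat using (ℕ; suc; _*_; _^_; _≤_; _<_; _∸_)
open import Data.Nat.Primality using (Prime)
open import Data.Nat.Combinatorics using (_C_)
open import Data.Fin using (Fin)
open import Data.List using (List; length)
open import Data.List.Relation.Unary.All using (All)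
open import Data.List.Relation.Unary.Unique.Propositional using (Unique)
open import Data.Product using (Σ; ∃; _×_)
open import Relation.Nullary using (¬_)
open import Relation.Binary.PropositionalEquality using (_≡_)
open import Algebra.Bundles using (CommutativeRing)

lemma2p1 : ∀ {c ℓ} (q m t d : ℕ)
  → (∃ λ p → ∃ λ k → Prime p × q ≡ p ^ suc k)
  → 1 ≤ m → 1 ≤ t → m ∸ 1 ≤ d → m C 2 < q
  → (F : FiniteField q)
  → (K : CommutativeRing c ℓ) (ι : Fin q → CommutativeRing.Carrier K)
  → IsAlgebraicClosure F K ι
  → (x : Fin m → Fin t → CommutativeRing.Carrier K)
  → (∀ i j → ¬ i ≡ j → ¬ (∀ k → CommutativeRing._≈_ K (x i k) (x j k)))
  → (S : List (Poly q t d))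
  → Unique S
  → All (λ f → ∀ i → CommutativeRing._≈_ K (evalPoly K ι f (x i)) (CommutativeRing.0# K)) S
  → length S * q ^ m ≤ q ^ length (monomials t d)
lemma2p1 q m zero    d _ _ () _ _ _ _ _ _ _ _ _ _ _
lemma2p1 q m (suc t) d _ _ _ m∸1≤d C₂<q F K ι K-closure x x-distinct S unique vanish =
  decidable-stable (_ ≤? _) λ ¬bound →
    ¬¬-separatingForm x x-distinct pairs<q λ (l , separates) →
      ¬bound (Counting.count F K ι isHom isField m≤1+d x l separates S unique vanish)
  where
  open IsAlgebraicClosure K-closure using (isField; isHom)
  open SeparatingForm F K ι isHom isField using (¬¬-separatingForm)
  pairs<q : pairs m < q
  pairs<q = ≡.subst (_< q) (≡.sym (pairs≡C₂ m)) C₂<q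
  m≤1+d : m ≤ suc d
  m≤1+d = ≤-trans (m≤n+m∸n m 1) (s≤s m∸1≤d)
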